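{- Let $V$ be a vector space of dimension $n$ over a field, and let $g_1,\dots,g_{n+1}\in \mathrm{GL}(V)$ be such that $\mathrm{rank}(g_i-1)\le 1$ for all $i$ and $g_1\cdots g_{n+1}$ is the scalar $\mu$. If $\mu\ne 1$ and $\mu$ is not an eigenvalue of any $g_i$, then each $g_i$ is a pseudoreflection and $g_1,\dots,g_{n+1}$ generate an irreducible subgroup of $\mathrm{GL}(V)$.
   Context: An element $g\in\mathrm{GL}(V)$ is a pseudoreflection if $\mathrm{rank}(g-1)=1$. -}

module Defs where

open import Level using (Level; _⊔_)
open import Data.Nat using (ℕ; zero; suc)
open import Data.Fin using (Fin)
import Data.Fin as Fn
open import Data.Product using (Σ; ∃; _×_; _,_)
open import Relation.Nullary using (¬_)
open import Algebra.Bundles using (CommutativeRing)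

record Field (c ℓ : Level) : Set (Level.suc (c ⊔ ℓ)) where
  field
    commutativeRing : CommutativeRing c ℓ
  open CommutativeRing commutativeRing public
  field
    1≉0     : ¬ (1# ≈ 0#)
    inverse : ∀ x → ¬ (x ≈ 0#) → Σ Carrier λ y → (x * y) ≈ 1#

module LinAlg {c ℓ : Level} (F : Field c ℓ) where
  open Field F using (Carrier; _≈_; 0#; 1#; _+_; _*_; _-_)

  -- V = K^n (a vector space of dimension n with a chosen basis)
  Vec : ℕ → Set c
  Vec n = Fin n → Carrier

  Matrix : ℕ → Set c
  Matrix n = Fin n → Fin n → Carrier

  ∑ : ∀ {n} → (Fin n → Carrier) → Carrier
  ∑ {zero}  f = 0#
  ∑ {suc n} f = f Fn.zero + ∑ (λ i → f (Fn.suc i))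

  _≈ᵥ_ : ∀ {n} → Vec n → Vec n → Set ℓ
  u ≈ᵥ v = ∀ i → u i ≈ v i

  _≈ₘ_ : ∀ {n} → Matrix n → Matrix n → Set ℓ
  A ≈ₘ B = ∀ i j → A i j ≈ B i j

  0ᵥ : ∀ {n} → Vec n
  0ᵥ _ = 0#

  _+ᵥ_ : ∀ {n} → Vec n → Vec n → Vec n
  (u +ᵥ v) i = u i + v i

  _·ᵥ_ : ∀ {n} → Carrier → Vec n → Vec n
  (a ·ᵥ v) i = a * v i

  NonZeroVec : ∀ {n} → Vec n → Set ℓ
  NonZeroVec v = ¬ (v ≈ᵥ 0ᵥ)

  _$_ : ∀ {n} → Matrix n → Vec n → Vec n
  (A $ v) i = ∑ λ j → A i j * v j

  _*ₘ_ : ∀ {n} → Matrix n → Matrix n → Matrix n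
  (A *ₘ B) i j = ∑ λ k → A i k * B k j

  δ : ∀ {n} → Fin n → Fin n → Carrier
  δ Fn.zero    Fn.zero    = 1#
  δ Fn.zero    (Fn.suc j) = 0#
  δ (Fn.suc i) Fn.zero    = 0#
  δ (Fn.suc i) (Fn.suc j) = δ i j

  Iₘ : ∀ {n} → Matrix n
  Iₘ = δ

  scalar : ∀ {n} → Carrier → Matrix n
  scalar a i j = a * δ i j

  _-ₘ_ : ∀ {n} → Matrix n → Matrix n → Matrix n
  (A -ₘ B) i j = A i j - B i j

  prodₘ : ∀ {n m} → (Fin m → Matrix n) → Matrix n
  prodₘ {m = zero}  A = Iₘ
  prodₘ {m = suc m} A = A Fn.zero *ₘ prodₘ (λ k → A (Fn.suc k))

  -- h is a two-sided inverse of g (so g ∈ GL(V))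
  IsInverse : ∀ {n} → Matrix n → Matrix n → Set ℓ
  IsInverse g h = ((g *ₘ h) ≈ₘ Iₘ) × ((h *ₘ g) ≈ₘ Iₘ)

  RankLe1 : ∀ {n} → Matrix n → Set (c ⊔ ℓ)
  RankLe1 {n} A = Σ (Vec n) λ u → ∀ (x : Vec n) → Σ Carrier λ a → (A $ x) ≈ᵥ (a ·ᵥ u)

  RankGe1 : ∀ {n} → Matrix n → Set (c ⊔ ℓ)
  RankGe1 {n} A = Σ (Vec n) λ x → NonZeroVec (A $ x)

  IsPseudoreflection : ∀ {n} → Matrix n → Set (c ⊔ ℓ)
  IsPseudoreflection g = RankLe1 (g -ₘ Iₘ) × RankGe1 (g -ₘ Iₘ)

  IsEigenvalue : ∀ {n} → Carrier → Matrix n → Set (c ⊔ ℓ)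
  IsEigenvalue {n} μ g = Σ (Vec n) λ v → NonZeroVec v × ((g $ v) ≈ᵥ (μ ·ᵥ v))

  data InGenerated {n m : ℕ} (g ginv : Fin m → Matrix n) : Matrix n → Set (c ⊔ ℓ) where
    gen   : ∀ i → InGenerated g ginv (g i)
    genⁱ  : ∀ i → InGenerated g ginv (ginv i)
    one   : InGenerated g ginv Iₘ
    mul   : ∀ {A B} → InGenerated g ginv A → InGenerated g ginv B → InGenerated g ginv (A *ₘ B)
    resp  : ∀ {A B} → A ≈ₘ B → InGenerated g ginv A → InGenerated g ginv B

  record Subspace (n : ℕ) : Set (Level.suc (c ⊔ ℓ)) where
    field
      _∈W      : Vec n → Set (c ⊔ ℓ)
      respects : ∀ {u v} → u ≈ᵥ v → u ∈W → v ∈W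
      zero∈    : 0ᵥ ∈W
      +-closed : ∀ {u v} → u ∈W → v ∈W → (u +ᵥ v) ∈W
      ·-closed : ∀ a {v} → v ∈W → (a ·ᵥ v) ∈W

  Irreducible : ∀ {n} → (Matrix n → Set (c ⊔ ℓ)) → Set (Level.suc (c ⊔ ℓ))
  Irreducible {n} G =
    ¬ (Σ (Subspace n) λ W → let open Subspace W in
         (∀ A → G A → ∀ v → v ∈W → (A $ v) ∈W)
       × (Σ (Vec n) λ w → w ∈W × NonZeroVec w)
       × (Σ (Vec n) λ v → ¬ (v ∈W)))

open LinAlg public

-- Write gᵢ = 1 + uᵢ aᵢ. The heart of the proof is that gᵢ never fixes uⱼ for i ≠ j; since the
-- relation g₀ ⋯ gₙ = μ survives cyclic rotation, it suffices to take i = 0. A functional killing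
-- u₁, …, uₙ is invariant under g₁, …, gₙ, hence satisfies ψ g₀ = μ ψ, which would make u₀ a
-- μ-eigenvector of g₀; so u₁, …, uₙ span V and, being n vectors, are a basis. If g₀ fixed uⱼ,
-- then g₁ ⋯ gₙ uⱼ = μ uⱼ, and expanding the left side by telescoping in this basis shows that
-- the factor with axis uⱼ already multiplies uⱼ by μ. Consequently every gᵢ − 1 is nonzero, and
-- a nonzero invariant subspace contains some uᵢ (otherwise all gᵢ fix its vectors, against
-- μ ≠ 1), hence every uⱼ, hence by telescoping g₀ ⋯ gₙ v = μ v every v.
-- Working constructively, spanning and independence hold only up to double negation, which is
-- enough because they are only ever used to derive a contradiction.

module Submission where

open import Level using (Level; _⊔_)
open import Function using (_∘_)
open import Data.Nat using (ℕ; zero; suc; _<_; _≤_; s≤s; z≤n)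
open import Data.Nat.Properties using (≤-refl)
open import Data.Fin using (Fin; zero; suc; punchIn; punchOut; inject₁; fromℕ)
open import Data.Fin.Properties using (punchIn-punchOut; suc-injective; _≟_)
open import Data.Fin.Induction using (<-weakInduction)
open import Data.Vec.Functional using (_∷_; tail)
open import Data.Product using (Σ; _×_; _,_; proj₁; proj₂)
open import Relation.Nullary using (¬_; yes; no)
open import Relation.Nullary.Negation using (¬¬-map; contradiction)
open import Relation.Binary.PropositionalEquality as ≡ using (_≡_; _≢_)
import Relation.Binary.Reasoning.Setoid as SetoidReasoning
import Algebra.Properties.Group
import Algebra.Properties.AbelianGroup
import Algebra.Properties.CommutativeSemigroup
import Algebra.Properties.Ring
import Algebra.Properties.Semiring.Sum
import Data.Vec.Functional.Relation.Binary.Equality.Setoid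
import Defs
open Defs using (Field)

¬¬-distrib-∀ : ∀ {k a} {Q : Fin k → Set a} → (∀ i → ¬ ¬ Q i) → ¬ ¬ (∀ i → Q i)
¬¬-distrib-∀ {zero}  _   ¬all = ¬all (λ ())
¬¬-distrib-∀ {suc k} ¬¬Q ¬all =
  ¬¬Q zero λ q₀ → ¬¬-distrib-∀ (¬¬Q ∘ suc) λ qs → ¬all λ { zero → q₀ ; (suc i) → qs i }

¬∀⇒¬¬∃¬ : ∀ {k a} {Q : Fin k → Set a} → ¬ (∀ i → Q i) → ¬ ¬ Σ (Fin k) (λ i → ¬ Q i)
¬∀⇒¬¬∃¬ ¬all ¬ex = ¬¬-distrib-∀ (λ i ¬Qi → ¬ex (i , ¬Qi)) ¬all

∀-punchIn : ∀ {n p} {P : Fin (suc n) → Set p} (k : Fin (suc n)) →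
            P k → (∀ i → P (punchIn k i)) → ∀ i → P i
∀-punchIn {P = P} k Pk P-others i with i ≟ k
... | yes ≡.refl = Pk
... | no i≢k     = ≡.subst P (punchIn-punchOut k≢i) (P-others (punchOut k≢i))
  where k≢i = i≢k ∘ ≡.sym

-- The cyclic successor 0 ↦ 1 ↦ ⋯ ↦ n ↦ 0 on Fin (suc n); punchIn 1 makes room for the new index 1.
suc-cyclic : ∀ {n} → Fin (suc n) → Fin (suc n)
suc-cyclic {zero}  zero    = zero
suc-cyclic {suc n} zero    = suc zero
suc-cyclic {suc n} (suc i) = punchIn (suc zero) (suc-cyclic i)

suc-cyclic-inject₁ : ∀ {n} (i : Fin n) → suc-cyclic (inject₁ i) ≡ suc i
suc-cyclic-inject₁ zero    = ≡.refl
suc-cyclic-inject₁ (suc i) = ≡.cong (punchIn (suc zero)) (suc-cyclic-inject₁ i)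

suc-cyclic-fromℕ : ∀ n → suc-cyclic (fromℕ n) ≡ zero
suc-cyclic-fromℕ zero    = ≡.refl
suc-cyclic-fromℕ (suc n) = ≡.cong (punchIn (suc zero)) (suc-cyclic-fromℕ n)

suc-cyclic-surjective : ∀ {n} (j : Fin (suc n)) → Σ (Fin (suc n)) λ i → suc-cyclic i ≡ j
suc-cyclic-surjective {n} zero = fromℕ n , suc-cyclic-fromℕ n
suc-cyclic-surjective (suc j)  = inject₁ j , suc-cyclic-inject₁ j

another : ∀ {m} (i : Fin (suc (suc m))) → Σ (Fin (suc (suc m))) (i ≢_)
another zero    = suc zero , λ ()
another (suc i) = zero , λ ()

module _ {c ℓ : Level} (F : Field c ℓ) where
  open Field F hiding (zero)
  open Defs.LinAlg F
  open Algebra.Properties.Group +-group using (x∙y⁻¹≈ε⇒x≈y)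
  open Algebra.Properties.Ring ring using (-1*x≈-x; -‿distribʳ-*; [y-z]x≈yx-zx)
  open Data.Vec.Functional.Relation.Binary.Equality.Setoid setoid using (≋-setoid)
  open Algebra.Properties.AbelianGroup +-abelianGroup using (xyx⁻¹≈y)
  open Algebra.Properties.CommutativeSemigroup *-commutativeSemigroup using (x∙yz≈y∙xz; x∙yz≈yx∙z; xy∙z≈y∙xz)
  module Sum = Algebra.Properties.Semiring.Sum semiring
  module ≈-Reasoning = SetoidReasoning setoid
  module ≈ᵥ-Reasoning (n : ℕ) = SetoidReasoning (≋-setoid n)

  x-y≈0⇒x≈y : ∀ {x y} → x - y ≈ 0# → x ≈ y
  x-y≈0⇒x≈y = x∙y⁻¹≈ε⇒x≈y _ _

  left-inverse : ∀ {a} → ¬ a ≈ 0# → Σ Carrier λ b → b * a ≈ 1#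
  left-inverse {a} a≉0 with inverse a a≉0
  ... | b , ab≈1 = b , trans (*-comm b a) ab≈1

  nonzero-cancelˡ : ∀ {a x} → ¬ a ≈ 0# → a * x ≈ 0# → x ≈ 0#
  nonzero-cancelˡ {a} {x} a≉0 ax≈0 with left-inverse a≉0
  ... | b , ba≈1 = begin
    x            ≈⟨ *-identityˡ x ⟨
    1# * x       ≈⟨ *-congʳ ba≈1 ⟨
    (b * a) * x  ≈⟨ *-assoc b a x ⟩
    b * (a * x)  ≈⟨ *-congˡ ax≈0 ⟩
    b * 0#       ≈⟨ zeroʳ b ⟩
    0#           ∎
    where open ≈-Reasoning

  x+[y-x]≈y : ∀ x y → x + (y - x) ≈ y
  x+[y-x]≈y x y = trans (sym (+-assoc x y (- x))) (xyx⁻¹≈y x y)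

  [μ-1]x≈μx-x : ∀ μ x → (μ - 1#) * x ≈ μ * x - x
  [μ-1]x≈μx-x μ x = trans ([y-z]x≈yx-zx x μ 1#) (+-congˡ (-‿cong (*-identityˡ x)))

  μ-1≉0 : ∀ {μ} → ¬ μ ≈ 1# → ¬ μ - 1# ≈ 0#
  μ-1≉0 μ≉1 = μ≉1 ∘ x-y≈0⇒x≈y

  x≈μx⇒x≈0 : ∀ {μ x} → ¬ μ ≈ 1# → x ≈ μ * x → x ≈ 0#
  x≈μx⇒x≈0 {μ} {x} μ≉1 x≈μx = nonzero-cancelˡ (μ-1≉0 μ≉1) (begin
    (μ - 1#) * x  ≈⟨ [μ-1]x≈μx-x μ x ⟩
    μ * x - x     ≈⟨ +-congʳ x≈μx ⟨
    x - x         ≈⟨ -‿inverseʳ x ⟩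
    0#            ∎)
    where open ≈-Reasoning

  x+y≈μx⇒y≈[μ-1]x : ∀ {μ x y} → x + y ≈ μ * x → y ≈ (μ - 1#) * x
  x+y≈μx⇒y≈[μ-1]x {μ} {x} {y} x+y≈μx = begin
    y             ≈⟨ xyx⁻¹≈y x y ⟨
    (x + y) - x   ≈⟨ +-congʳ x+y≈μx ⟩
    μ * x - x     ≈⟨ [μ-1]x≈μx-x μ x ⟨
    (μ - 1#) * x  ∎
    where open ≈-Reasoning

  1+a≈μ⇒x+ax≈μx : ∀ {a μ} x → 1# + a ≈ μ → x + a * x ≈ μ * x
  1+a≈μ⇒x+ax≈μx {a} {μ} x 1+a≈μ = begin
    x + a * x       ≈⟨ +-congʳ (*-identityˡ x) ⟨
    1# * x + a * x  ≈⟨ distribʳ x 1# a ⟨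
    (1# + a) * x    ≈⟨ *-congʳ 1+a≈μ ⟩
    μ * x           ∎
    where open ≈-Reasoning

  ∑≡sum : ∀ {k} (f : Fin k → Carrier) → ∑ f ≡ Sum.sum f
  ∑≡sum {zero}  f = ≡.refl
  ∑≡sum {suc k} f = ≡.cong (f zero +_) (∑≡sum (f ∘ suc))

  ∑-cong : ∀ {k} {f g : Fin k → Carrier} → (∀ i → f i ≈ g i) → ∑ f ≈ ∑ g
  ∑-cong {zero}  _   = refl
  ∑-cong {suc k} f≈g = +-cong (f≈g zero) (∑-cong (f≈g ∘ suc))

  ∑-zero : ∀ {k} {f : Fin k → Carrier} → (∀ i → f i ≈ 0#) → ∑ f ≈ 0#
  ∑-zero {zero}  _    = refl
  ∑-zero {suc k} f≈0 = trans (+-cong (f≈0 zero) (∑-zero (f≈0 ∘ suc))) (+-identityˡ 0#)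

  ∑-+ : ∀ {k} (f g : Fin k → Carrier) → ∑ (λ i → f i + g i) ≈ ∑ f + ∑ g
  ∑-+ f g rewrite ∑≡sum (λ i → f i + g i) | ∑≡sum f | ∑≡sum g = Sum.∑-distrib-+ f g

  ∑-*ˡ : ∀ {k} a (f : Fin k → Carrier) → ∑ (λ i → a * f i) ≈ a * ∑ f
  ∑-*ˡ a f rewrite ∑≡sum (λ i → a * f i) | ∑≡sum f = sym (Sum.*-distribˡ-sum a f)

  ∑-remove : ∀ {k} (f : Fin (suc k) → Carrier) j → ∑ f ≈ f j + ∑ (λ i → f (punchIn j i))
  ∑-remove f j rewrite ∑≡sum f | ∑≡sum (λ i → f (punchIn j i)) = Sum.sum-remove f

  ∑-swap : ∀ {k m} (f : Fin k → Fin m → Carrier) →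
           ∑ (λ i → ∑ (f i)) ≈ ∑ (λ j → ∑ (λ i → f i j))
  ∑-swap f = begin
    ∑ (λ i → ∑ (f i))                      ≡⟨ ∑∑≡sumsum f ⟩
    Sum.sum (λ i → Sum.sum (f i))          ≈⟨ Sum.∑-comm f ⟩
    Sum.sum (λ j → Sum.sum (λ i → f i j))  ≡⟨ ∑∑≡sumsum (λ j i → f i j) ⟨
    ∑ (λ j → ∑ (λ i → f i j))              ∎
    where
    open ≈-Reasoning
    ∑∑≡sumsum : ∀ {k m} (g : Fin k → Fin m → Carrier) → ∑ (λ i → ∑ (g i)) ≡ Sum.sum (λ i → Sum.sum (g i))
    ∑∑≡sumsum g = ≡.trans (∑≡sum (λ i → ∑ (g i))) (Sum.sum-cong-≗ (λ i → ∑≡sum (g i)))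

  ∑-δˡ : ∀ {k} (j : Fin k) (f : Fin k → Carrier) → ∑ (λ i → δ j i * f i) ≈ f j
  ∑-δˡ zero    f = trans (+-cong (*-identityˡ _) (∑-zero {f = λ i → 0# * f (suc i)} λ i → zeroˡ _))
                          (+-identityʳ _)
  ∑-δˡ (suc j) f = trans (+-cong (zeroˡ _) (∑-δˡ j (f ∘ suc))) (+-identityˡ _)

  δ-diag : ∀ {k} (i : Fin k) → δ i i ≡ 1#
  δ-diag zero    = ≡.refl
  δ-diag (suc i) = δ-diag i

  δ-off : ∀ {k} {i j : Fin k} → i ≢ j → δ i j ≡ 0#
  δ-off {i = zero}  {zero}  i≢j = contradiction ≡.refl i≢j
  δ-off {i = zero}  {suc j} _   = ≡.refl
  δ-off {i = suc i} {zero}  _   = ≡.refl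
  δ-off {i = suc i} {suc j} i≢j = δ-off (i≢j ∘ ≡.cong suc)

  ∑-− : ∀ {k} (f g : Fin k → Carrier) → ∑ (λ i → f i - g i) ≈ ∑ f - ∑ g
  ∑-− f g = begin
    ∑ (λ i → f i - g i)         ≈⟨ ∑-+ f (λ i → - g i) ⟩
    ∑ f + ∑ (λ i → - g i)       ≈⟨ +-congˡ (∑-cong λ i → -1*x≈-x (g i)) ⟨
    ∑ f + ∑ (λ i → - 1# * g i)  ≈⟨ +-congˡ (∑-*ˡ (- 1#) g) ⟩
    ∑ f + - 1# * ∑ g            ≈⟨ +-congˡ (-1*x≈-x (∑ g)) ⟩
    ∑ f - ∑ g                   ∎
    where open ≈-Reasoning

  dot : ∀ {k} → Vec k → Vec k → Carrier
  dot a v = ∑ λ j → a j * v j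

  dot-cong : ∀ {k} {a b u v : Vec k} → a ≈ᵥ b → u ≈ᵥ v → dot a u ≈ dot b v
  dot-cong a≈b u≈v = ∑-cong λ j → *-cong (a≈b j) (u≈v j)

  dot-congʳ : ∀ {k} (a : Vec k) {u v : Vec k} → u ≈ᵥ v → dot a u ≈ dot a v
  dot-congʳ a = dot-cong λ _ → refl

  dot-comm : ∀ {k} (a b : Vec k) → dot a b ≈ dot b a
  dot-comm a b = ∑-cong λ j → *-comm (a j) (b j)

  dot-+ʳ : ∀ {k} (a u v : Vec k) → dot a (u +ᵥ v) ≈ dot a u + dot a v
  dot-+ʳ a u v = trans (∑-cong λ j → distribˡ (a j) (u j) (v j))
                     (∑-+ (λ j → a j * u j) (λ j → a j * v j))

  dot-·ʳ : ∀ {k} (a : Vec k) x (u : Vec k) → dot a (x ·ᵥ u) ≈ x * dot a u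
  dot-·ʳ a x u = trans (∑-cong λ j → x∙yz≈y∙xz (a j) x (u j)) (∑-*ˡ x λ j → a j * u j)

  dot-·ˡ : ∀ {k} x (a u : Vec k) → dot (x ·ᵥ a) u ≈ x * dot a u
  dot-·ˡ x a u = trans (∑-cong λ j → *-assoc x (a j) (u j)) (∑-*ˡ x λ j → a j * u j)

  dot-0ʳ : ∀ {k} (a : Vec k) → dot a 0ᵥ ≈ 0#
  dot-0ʳ a = ∑-zero λ j → zeroʳ (a j)

  dot-−ˡ : ∀ {k} (a b u : Vec k) → dot (λ j → a j - b j) u ≈ dot a u - dot b u
  dot-−ˡ a b u = trans (∑-cong λ j → [y-z]x≈yx-zx (u j) (a j) (b j))
                     (∑-− (λ j → a j * u j) (λ j → b j * u j))

  dot-basisʳ : ∀ {k} (a : Vec k) j → dot a (δ j) ≈ a j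
  dot-basisʳ a j = trans (dot-comm a (δ j)) (∑-δˡ j a)

  lc : ∀ {k m} → (Fin k → Carrier) → (Fin k → Vec m) → Vec m
  lc d w r = dot d λ i → w i r

  lc-basis : ∀ {k m} (j : Fin k) (w : Fin k → Vec m) → lc (δ j) w ≈ᵥ w j
  lc-basis j w r = ∑-δˡ j λ i → w i r

  dot-lc : ∀ {k m} (ψ : Vec m) (d : Fin k → Carrier) (w : Fin k → Vec m) →
           dot ψ (lc d w) ≈ dot d (λ i → dot (w i) ψ)
  dot-lc ψ d w = begin
    ∑ (λ r → ψ r * ∑ (λ i → d i * w i r))    ≈⟨ ∑-cong (λ r → ∑-*ˡ (ψ r) λ i → d i * w i r) ⟨
    ∑ (λ r → ∑ (λ i → ψ r * (d i * w i r)))  ≈⟨ ∑-swap (λ r i → ψ r * (d i * w i r)) ⟩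
    ∑ (λ i → ∑ (λ r → ψ r * (d i * w i r)))  ≈⟨ ∑-cong (λ i → ∑-cong λ r → x∙yz≈y∙xz (ψ r) (d i) (w i r)) ⟩
    ∑ (λ i → ∑ (λ r → d i * (ψ r * w i r)))  ≈⟨ ∑-cong (λ i → ∑-*ˡ (d i) λ r → ψ r * w i r) ⟩
    ∑ (λ i → d i * dot ψ (w i))              ≈⟨ ∑-cong (λ i → *-congˡ (dot-comm ψ (w i))) ⟩
    ∑ (λ i → d i * dot (w i) ψ)              ∎
    where open ≈-Reasoning

  $-congˡ : ∀ {n} {A B : Matrix n} → A ≈ₘ B → ∀ v → (A $ v) ≈ᵥ (B $ v)
  $-congˡ A≈B v i = dot-cong (A≈B i) λ _ → refl

  $-congʳ : ∀ {n} (A : Matrix n) {u v : Vec n} → u ≈ᵥ v → (A $ u) ≈ᵥ (A $ v)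
  $-congʳ A u≈v i = dot-congʳ (A i) u≈v

  $-· : ∀ {n} (A : Matrix n) a (v : Vec n) → (A $ (a ·ᵥ v)) ≈ᵥ (a ·ᵥ (A $ v))
  $-· A a v i = dot-·ʳ (A i) a v

  $-I : ∀ {n} (v : Vec n) → (Iₘ $ v) ≈ᵥ v
  $-I v i = ∑-δˡ i v

  $-scalar : ∀ {n} μ (v : Vec n) → (scalar μ $ v) ≈ᵥ (μ ·ᵥ v)
  $-scalar μ v i = trans (dot-·ˡ μ (δ i) v) (*-congˡ (∑-δˡ i v))

  $-* : ∀ {n} (A B : Matrix n) (v : Vec n) → ((A *ₘ B) $ v) ≈ᵥ (A $ (B $ v))
  $-* A B v i = begin
    ∑ (λ j → ∑ (λ k → A i k * B k j) * v j)    ≈⟨ ∑-cong (λ j → *-comm _ (v j)) ⟩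
    ∑ (λ j → v j * ∑ (λ k → A i k * B k j))    ≈⟨ ∑-cong (λ j → ∑-*ˡ (v j) λ k → A i k * B k j) ⟨
    ∑ (λ j → ∑ (λ k → v j * (A i k * B k j)))  ≈⟨ ∑-swap (λ j k → v j * (A i k * B k j)) ⟩
    ∑ (λ k → ∑ (λ j → v j * (A i k * B k j)))  ≈⟨ ∑-cong (λ k → ∑-cong λ j → x∙yz≈y∙xz (v j) (A i k) (B k j)) ⟩
    ∑ (λ k → ∑ (λ j → A i k * (v j * B k j)))  ≈⟨ ∑-cong (λ k → ∑-*ˡ (A i k) λ j → v j * B k j) ⟩
    ∑ (λ k → A i k * dot v (B k))              ≈⟨ ∑-cong (λ k → *-congˡ (dot-comm v (B k))) ⟩
    ∑ (λ k → A i k * (B $ v) k)                ∎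
    where open ≈-Reasoning

  $-−I : ∀ {n} (A : Matrix n) (x : Vec n) i → ((A -ₘ Iₘ) $ x) i ≈ (A $ x) i - x i
  $-−I A x i = trans (dot-−ˡ (A i) (δ i) x) (+-congˡ (-‿cong (∑-δˡ i x)))

  *-cancelʳ-nonzero : ∀ {a x y} → ¬ a ≈ 0# → x * a ≈ y * a → x ≈ y
  *-cancelʳ-nonzero {a} {x} {y} a≉0 xa≈ya = x-y≈0⇒x≈y (nonzero-cancelˡ a≉0 (begin
    a * (x - y)    ≈⟨ *-comm a (x - y) ⟩
    (x - y) * a    ≈⟨ [y-z]x≈yx-zx a x y ⟩
    x * a - y * a  ≈⟨ +-congʳ xa≈ya ⟩
    y * a - y * a  ≈⟨ -‿inverseʳ (y * a) ⟩
    0#             ∎))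
    where open ≈-Reasoning

  axis : ∀ {n} {A : Matrix n} → RankLe1 A → Vec n
  axis = proj₁

  coeff : ∀ {n} {A : Matrix n} → RankLe1 A → Vec n → Carrier
  coeff rk x = proj₁ (proj₂ rk x)

  image-on-axis : ∀ {n} {A : Matrix n} (rk : RankLe1 A) x → (A $ x) ≈ᵥ (coeff rk x ·ᵥ axis rk)
  image-on-axis rk x = proj₂ (proj₂ rk x)

  kernel⇒fixed : ∀ {n} (A : Matrix n) {x : Vec n} → ((A -ₘ Iₘ) $ x) ≈ᵥ 0ᵥ → (A $ x) ≈ᵥ x
  kernel⇒fixed A {x} [A-I]x≈0 i = x-y≈0⇒x≈y (trans (sym ($-−I A x i)) ([A-I]x≈0 i))

  perturbation-$ : ∀ {n} {A : Matrix n} (rk : RankLe1 (A -ₘ Iₘ)) x →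
                   (A $ x) ≈ᵥ (x +ᵥ (coeff rk x ·ᵥ axis rk))
  perturbation-$ {A = A} rk x i = begin
    (A $ x) i                   ≈⟨ x+[y-x]≈y (x i) _ ⟨
    x i + ((A $ x) i - x i)     ≈⟨ +-congˡ ($-−I A x i) ⟨
    x i + ((A -ₘ Iₘ) $ x) i     ≈⟨ +-congˡ (image-on-axis rk x i) ⟩
    x i + coeff rk x * axis rk i ∎
    where open ≈-Reasoning

  coeff≈0⇒fixed : ∀ {n} {A : Matrix n} (rk : RankLe1 (A -ₘ Iₘ)) {x} → coeff rk x ≈ 0# → (A $ x) ≈ᵥ x
  coeff≈0⇒fixed rk {x} c≈0 i =
    trans (perturbation-$ rk x i) (trans (+-congˡ (trans (*-congʳ c≈0) (zeroˡ _))) (+-identityʳ (x i)))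

  dot-perturbation : ∀ {n} {A : Matrix n} (rk : RankLe1 (A -ₘ Iₘ)) (ψ x : Vec n) →
                     dot ψ (A $ x) ≈ dot ψ x + coeff rk x * dot ψ (axis rk)
  dot-perturbation rk ψ x =
    trans (dot-congʳ ψ (perturbation-$ rk x)) (trans (dot-+ʳ ψ x _) (+-congˡ (dot-·ʳ ψ _ (axis rk))))

  axis-annihilator-invariant : ∀ {n} {A : Matrix n} (rk : RankLe1 (A -ₘ Iₘ)) {ψ : Vec n} →
                               dot ψ (axis rk) ≈ 0# → ∀ x → dot ψ (A $ x) ≈ dot ψ x
  axis-annihilator-invariant {A = A} rk {ψ} ψu≈0 x = begin
    dot ψ (A $ x)                          ≈⟨ dot-perturbation rk ψ x ⟩
    dot ψ x + coeff rk x * dot ψ (axis rk)  ≈⟨ +-congˡ (trans (*-congˡ ψu≈0) (zeroʳ _)) ⟩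
    dot ψ x + 0#                           ≈⟨ +-identityʳ _ ⟩
    dot ψ x                                ∎
    where open ≈-Reasoning

  rank≤1-left-eigenvector⇒eigenvalue :
    ∀ {n μ} {A : Matrix n} (rk : RankLe1 (A -ₘ Iₘ)) → ¬ μ ≈ 1# → (ψ : Vec n) → NonZeroVec ψ →
    (∀ x → dot ψ (A $ x) ≈ μ * dot ψ x) → IsEigenvalue μ A
  rank≤1-left-eigenvector⇒eigenvalue {μ = μ} {A} rk μ≉1 ψ ψ≉0 ψA≈μψ = u , u≉0 , Au≈μu
    where
    open ≈-Reasoning
    u = axis rk
    D = dot ψ u
    ψ-shift : ∀ x → dot ψ x + coeff rk x * D ≈ μ * dot ψ x
    ψ-shift x = trans (sym (dot-perturbation rk ψ x)) (ψA≈μψ x)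
    D≉0 : ¬ D ≈ 0#
    D≉0 D≈0 = ψ≉0 λ j → trans (sym (dot-basisʳ ψ j)) (x≈μx⇒x≈0 μ≉1 (begin
      dot ψ (δ j)                            ≈⟨ +-identityʳ _ ⟨
      dot ψ (δ j) + 0#                       ≈⟨ +-congˡ (trans (*-congˡ D≈0) (zeroʳ _)) ⟨
      dot ψ (δ j) + coeff rk (δ j) * D       ≈⟨ ψ-shift (δ j) ⟩
      μ * dot ψ (δ j)                        ∎))
    u≉0 : NonZeroVec u
    u≉0 u≈0 = D≉0 (trans (dot-congʳ ψ u≈0) (dot-0ʳ ψ))
    1+a≈μ : 1# + coeff rk u ≈ μ
    1+a≈μ = *-cancelʳ-nonzero D≉0 (begin
      (1# + coeff rk u) * D       ≈⟨ distribʳ D 1# _ ⟩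
      1# * D + coeff rk u * D     ≈⟨ +-congʳ (*-identityˡ D) ⟩
      D + coeff rk u * D          ≈⟨ ψ-shift u ⟩
      μ * D                       ∎)
    Au≈μu : (A $ u) ≈ᵥ (μ ·ᵥ u)
    Au≈μu r = trans (perturbation-$ rk u r) (1+a≈μ⇒x+ax≈μx (u r) 1+a≈μ)

  NontrivialAnnihilator : ∀ {m N} → (Fin m → Vec N) → Set (c ⊔ ℓ)
  NontrivialAnnihilator {N = N} w = Σ (Vec N) λ ψ → (∀ i → dot (w i) ψ ≈ 0#) × NonZeroVec ψ

  -- Constructively, "w spans" is taken in its dual form: no nonzero functional kills every w i.
  Spans : ∀ {m N} → (Fin m → Vec N) → Set (c ⊔ ℓ)
  Spans w = ¬ NontrivialAnnihilator w

  LinearlyIndependent : ∀ {m N} → (Fin m → Vec N) → Set (c ⊔ ℓ)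
  LinearlyIndependent w = ∀ d → lc d w ≈ᵥ 0ᵥ → ¬ ¬ (∀ i → d i ≈ 0#)

  pivot-elimination : ∀ {m N} (rows : Fin (suc m) → Vec (suc N)) r → ¬ rows r zero ≈ 0# →
    Σ (Fin m → Vec N) λ reduced → NontrivialAnnihilator reduced → NontrivialAnnihilator rows
  pivot-elimination {m} {N} rows r pivot≉0 with left-inverse pivot≉0
  ... | p , p*pivot≈1 = reduced , extend
    where
    factor : Fin m → Carrier
    factor i = p * rows (punchIn r i) zero

    reduced : Fin m → Vec N
    reduced i j = rows (punchIn r i) (suc j) - factor i * rows r (suc j)

    extend : NontrivialAnnihilator reduced → NontrivialAnnihilator rows
    extend (ψ , ann , ψ≉0) = x₀ ∷ ψ , ∀-punchIn r pivot-row other-row , ψ≉0 ∘ (_∘ suc)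
      where
      D = dot (tail (rows r)) ψ
      x₀ = - (p * D)

      -- the value of a row on x₀ ∷ ψ is  b * x₀ + E  with  b  its first entry
      row-zero : ∀ b E → E ≈ b * (p * D) → b * x₀ + E ≈ 0#
      row-zero b E E≈bpD = begin
        b * x₀ + E                     ≈⟨ +-congʳ (-‿distribʳ-* b (p * D)) ⟨
        - (b * (p * D)) + E            ≈⟨ +-congˡ E≈bpD ⟩
        - (b * (p * D)) + b * (p * D)  ≈⟨ -‿inverseˡ _ ⟩
        0#                             ∎
        where open ≈-Reasoning

      pivot-row : dot (rows r) (x₀ ∷ ψ) ≈ 0#
      pivot-row = row-zero (rows r zero) D (sym (begin
        rows r zero * (p * D)  ≈⟨ x∙yz≈yx∙z (rows r zero) p D ⟩
        (p * rows r zero) * D  ≈⟨ *-congʳ p*pivot≈1 ⟩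
        1# * D                 ≈⟨ *-identityˡ D ⟩
        D                      ∎))
        where open ≈-Reasoning

      other-row : ∀ i → dot (rows (punchIn r i)) (x₀ ∷ ψ) ≈ 0#
      other-row i = row-zero (rows (punchIn r i) zero) E (begin
        E                                  ≈⟨ x-y≈0⇒x≈y (trans (sym reduced-value) (ann i)) ⟩
        factor i * D                       ≈⟨ xy∙z≈y∙xz p _ D ⟩
        rows (punchIn r i) zero * (p * D)  ∎)
        where
        open ≈-Reasoning
        E = dot (tail (rows (punchIn r i))) ψ
        reduced-value : dot (reduced i) ψ ≈ E - factor i * D
        reduced-value = trans (dot-−ˡ _ (factor i ·ᵥ tail (rows r)) ψ)
                              (+-congˡ (-‿cong (dot-·ˡ (factor i) (tail (rows r)) ψ)))

  m<N⇒¬¬annihilator : ∀ m {N} → m < N → (rows : Fin m → Vec N) → ¬ ¬ NontrivialAnnihilator rows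
  m<N⇒¬¬annihilator zero    {suc N} _         rows none = none (δ zero , (λ ()) , λ z → 1≉0 (z zero))
  m<N⇒¬¬annihilator (suc m) {suc N} (s≤s m<N) rows none =
    ¬∀⇒¬¬∃¬ pivot-exists λ (r , pivot≉0) →
      let (reduced , extend) = pivot-elimination rows r pivot≉0
      in m<N⇒¬¬annihilator m m<N reduced (none ∘ extend)
    where
    pivot-exists : ¬ (∀ r → rows r zero ≈ 0#)
    pivot-exists first-column≈0 =
      none (δ zero , (λ r → trans (dot-basisʳ (rows r) zero) (first-column≈0 r)) , λ z → 1≉0 (z zero))

  dependent⇒¬¬annihilator : ∀ {n} (w : Fin n → Vec n) d k → ¬ d k ≈ 0# → lc d w ≈ᵥ 0ᵥ →
                            ¬ ¬ NontrivialAnnihilator w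
  dependent⇒¬¬annihilator {suc n} w d k dₖ≉0 relation =
    ¬¬-map extend (m<N⇒¬¬annihilator n ≤-refl (w ∘ punchIn k))
    where
    extend : NontrivialAnnihilator (w ∘ punchIn k) → NontrivialAnnihilator w
    extend (ψ , ann , ψ≉0) = ψ , ∀-punchIn k annₖ ann , ψ≉0
      where
      open ≈-Reasoning
      annₖ : dot (w k) ψ ≈ 0#
      annₖ = nonzero-cancelˡ dₖ≉0 (begin
        d k * dot (w k) ψ                 ≈⟨ +-identityʳ _ ⟨
        d k * dot (w k) ψ + 0#            ≈⟨ +-congˡ (∑-zero λ i → trans (*-congˡ (ann i)) (zeroʳ _)) ⟨
        d k * dot (w k) ψ + ∑ (λ i → d (punchIn k i) * dot (w (punchIn k i)) ψ)
                                          ≈⟨ ∑-remove (λ i → d i * dot (w i) ψ) k ⟨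
        dot d (λ i → dot (w i) ψ)         ≈⟨ dot-lc ψ d w ⟨
        dot ψ (lc d w)                    ≈⟨ dot-congʳ ψ relation ⟩
        dot ψ 0ᵥ                          ≈⟨ dot-0ʳ ψ ⟩
        0#                                ∎)

  spans⇒linearlyIndependent : ∀ {n} (w : Fin n → Vec n) → Spans w → LinearlyIndependent w
  spans⇒linearlyIndependent w spans d relation ¬all≈0 =
    ¬∀⇒¬¬∃¬ ¬all≈0 λ (k , dₖ≉0) → dependent⇒¬¬annihilator w d k dₖ≉0 relation spans

  linearlyIndependent⇒nonzero : ∀ {m N} {w : Fin m → Vec N} → LinearlyIndependent w → ∀ j → NonZeroVec (w j)
  linearlyIndependent⇒nonzero {w = w} independent j wⱼ≈0 =
    independent (δ j) (λ r → trans (lc-basis j w r) (wⱼ≈0 r))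
      λ δⱼ≈0 → 1≉0 (trans (reflexive (≡.sym (δ-diag j))) (δⱼ≈0 j))

  module _ {n} (W : Subspace n) where
    open Subspace W

    lc-closed : ∀ {k} (d : Fin k → Carrier) (w : Fin k → Vec n) → (∀ i → w i ∈W) → lc d w ∈W
    lc-closed {zero}  d w _   = zero∈
    lc-closed {suc k} d w w∈ =
      +-closed (·-closed (d zero) (w∈ zero)) (lc-closed (d ∘ suc) (w ∘ suc) (w∈ ∘ suc))

    ·-cancel : ∀ {a v} → ¬ a ≈ 0# → (a ·ᵥ v) ∈W → v ∈W
    ·-cancel {a} {v} a≉0 av∈ with left-inverse a≉0
    ... | b , ba≈1 =
      respects (λ r → trans (sym (*-assoc b a (v r))) (trans (*-congʳ ba≈1) (*-identityˡ (v r))))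
               (·-closed b av∈)

    -ₘIₘ-closed : ∀ (A : Matrix n) {x} → x ∈W → (A $ x) ∈W → ((A -ₘ Iₘ) $ x) ∈W
    -ₘIₘ-closed A {x} x∈ Ax∈ =
      respects (λ r → trans (+-congˡ (-1*x≈-x (x r))) (sym ($-−I A x r))) (+-closed Ax∈ (·-closed (- 1#) x∈))

  prodₘ-fixes : ∀ {k n} (hs : Fin k → Matrix n) {x : Vec n} → (∀ i → (hs i $ x) ≈ᵥ x) → (prodₘ hs $ x) ≈ᵥ x
  prodₘ-fixes {zero}  hs {x} _     = $-I x
  prodₘ-fixes {suc k} hs {x} fixed r =
    trans ($-* (hs zero) _ x r)
          (trans ($-congʳ (hs zero) (prodₘ-fixes (hs ∘ suc) (fixed ∘ suc)) r) (fixed zero r))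

  prodₘ-preserves : ∀ {k n} (hs : Fin k → Matrix n) (ψ : Vec n) → (∀ i y → dot ψ (hs i $ y) ≈ dot ψ y) →
                    ∀ y → dot ψ (prodₘ hs $ y) ≈ dot ψ y
  prodₘ-preserves {zero}  hs ψ _         y = dot-congʳ ψ ($-I y)
  prodₘ-preserves {suc k} hs ψ preserved y =
    trans (dot-congʳ ψ ($-* (hs zero) _ y))
          (trans (preserved zero _) (prodₘ-preserves (hs ∘ suc) ψ (preserved ∘ suc) y))

  suffix : ∀ {k n} → (Fin k → Matrix n) → Fin k → Matrix n
  suffix hs zero    = prodₘ (hs ∘ suc)
  suffix hs (suc j) = suffix (hs ∘ suc) j

  telescope-coeff : ∀ {k n} (hs : Fin k → Matrix n) → (∀ i → RankLe1 (hs i -ₘ Iₘ)) → Vec n → Fin k → Carrier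
  telescope-coeff hs rk x i = coeff (rk i) (suffix hs i $ x)

  -- h₀ ⋯ hₖ₋₁ x = x + ∑ᵢ aᵢ(hᵢ₊₁ ⋯ hₖ₋₁ x) uᵢ  when  hᵢ = 1 + uᵢ aᵢ
  telescope : ∀ {k n} (hs : Fin k → Matrix n) (rk : ∀ i → RankLe1 (hs i -ₘ Iₘ)) x →
              (prodₘ hs $ x) ≈ᵥ (x +ᵥ lc (telescope-coeff hs rk x) (axis ∘ rk))
  telescope {zero}  hs rk x r = trans ($-I x r) (sym (+-identityʳ (x r)))
  telescope {suc k} hs rk x r = begin
    ((hs zero *ₘ prodₘ (hs ∘ suc)) $ x) r  ≈⟨ $-* (hs zero) _ x r ⟩
    (hs zero $ y) r                        ≈⟨ perturbation-$ (rk zero) y r ⟩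
    y r + c₀                               ≈⟨ +-congʳ (telescope (hs ∘ suc) (rk ∘ suc) x r) ⟩
    (x r + L) + c₀                         ≈⟨ +-assoc (x r) L c₀ ⟩
    x r + (L + c₀)                         ≈⟨ +-congˡ (+-comm L c₀) ⟩
    x r + (c₀ + L)                         ∎
    where
    open ≈-Reasoning
    y = prodₘ (hs ∘ suc) $ x
    c₀ = coeff (rk zero) y * axis (rk zero) r
    L = lc (telescope-coeff (hs ∘ suc) (rk ∘ suc) x) (axis ∘ rk ∘ suc) r

  telescope-eigenvector : ∀ {k n μ} (hs : Fin k → Matrix n) (rk : ∀ i → RankLe1 (hs i -ₘ Iₘ)) {v} →
                          (prodₘ hs $ v) ≈ᵥ (μ ·ᵥ v) →
                          lc (telescope-coeff hs rk v) (axis ∘ rk) ≈ᵥ ((μ - 1#) ·ᵥ v)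
  telescope-eigenvector hs rk {v} Pv≈μv r = x+y≈μx⇒y≈[μ-1]x (trans (sym (telescope hs rk v r)) (Pv≈μv r))

  suffix-fixes : ∀ {k n} (hs : Fin k → Matrix n) (rk : ∀ i → RankLe1 (hs i -ₘ Iₘ)) x j →
                 (∀ i → i ≢ j → telescope-coeff hs rk x i ≈ 0#) → (suffix hs j $ x) ≈ᵥ x
  suffix-fixes hs rk x zero c≈0 r = begin
    (prodₘ (hs ∘ suc) $ x) r  ≈⟨ telescope (hs ∘ suc) (rk ∘ suc) x r ⟩
    x r + lc (telescope-coeff (hs ∘ suc) (rk ∘ suc) x) (axis ∘ rk ∘ suc) r
                              ≈⟨ +-congˡ (∑-zero λ i → trans (*-congʳ (c≈0 (suc i) λ ())) (zeroˡ _)) ⟩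
    x r + 0#                  ≈⟨ +-identityʳ (x r) ⟩
    x r                       ∎
    where open ≈-Reasoning
  suffix-fixes hs rk x (suc j) c≈0 =
    suffix-fixes (hs ∘ suc) (rk ∘ suc) x j λ i i≢j → c≈0 (suc i) (i≢j ∘ suc-injective)

  prodₘ-rotate : ∀ {m n} (h : Fin (suc m) → Matrix n) x →
                 (prodₘ (h ∘ suc-cyclic) $ x) ≈ᵥ (prodₘ (h ∘ suc) $ (h zero $ x))
  prodₘ-rotate {zero}  h x r =
    trans ($-* (h zero) Iₘ x r) (trans ($-congʳ (h zero) ($-I x) r) (sym ($-I (h zero $ x) r)))
  prodₘ-rotate {suc m} h x r = begin
    ((h (suc zero) *ₘ prodₘ (h′ ∘ suc-cyclic)) $ x) r       ≈⟨ $-* (h (suc zero)) _ x r ⟩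
    (h (suc zero) $ (prodₘ (h′ ∘ suc-cyclic) $ x)) r       ≈⟨ $-congʳ (h (suc zero)) (prodₘ-rotate h′ x) r ⟩
    (h (suc zero) $ (prodₘ (h′ ∘ suc) $ (h zero $ x))) r   ≈⟨ $-* (h (suc zero)) _ (h zero $ x) r ⟨
    ((h (suc zero) *ₘ prodₘ (h′ ∘ suc)) $ (h zero $ x)) r  ∎
    where
    open ≈-Reasoning
    h′ = h ∘ punchIn (suc zero)

  ≈scalar⇒$ : ∀ {n μ} {A : Matrix n} → A ≈ₘ scalar μ → ∀ x → (A $ x) ≈ᵥ (μ ·ᵥ x)
  ≈scalar⇒$ {μ = μ} A≈μ x i = trans ($-congˡ A≈μ x i) ($-scalar μ x i)

  record ScalarRelation (n : ℕ) : Set (c ⊔ ℓ) where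
    field
      g ginv           : Fin (suc n) → Matrix n
      μ                : Carrier
      isInverse        : ∀ i → IsInverse (g i) (ginv i)
      rank≤1           : ∀ i → RankLe1 (g i -ₘ Iₘ)
      product          : ∀ x → (prodₘ g $ x) ≈ᵥ (μ ·ᵥ x)
      μ≉1              : ¬ μ ≈ 1#
      μ-not-eigenvalue : ∀ i → ¬ IsEigenvalue μ (g i)

    u : Fin (suc n) → Vec n
    u = axis ∘ rank≤1

    tail-after-head : ∀ x → (prodₘ (g ∘ suc) $ (g zero $ x)) ≈ᵥ (μ ·ᵥ x)
    tail-after-head x = begin
      P $ y                            ≈⟨ ginv-cancel (P $ y) ⟨
      ginv zero $ (g zero $ (P $ y))   ≈⟨ $-congʳ (ginv zero) ($-* (g zero) P y) ⟨
      ginv zero $ (prodₘ g $ y)        ≈⟨ $-congʳ (ginv zero) (product y) ⟩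
      ginv zero $ (μ ·ᵥ y)             ≈⟨ $-· (ginv zero) μ y ⟩
      μ ·ᵥ (ginv zero $ y)             ≈⟨ (λ r → *-congˡ (ginv-cancel x r)) ⟩
      μ ·ᵥ x                           ∎
      where
      open ≈ᵥ-Reasoning n
      P = prodₘ (g ∘ suc)
      y = g zero $ x
      ginv-cancel : ∀ z → (ginv zero $ (g zero $ z)) ≈ᵥ z
      ginv-cancel z r =
        trans (sym ($-* (ginv zero) (g zero) z r)) (trans ($-congˡ (proj₂ (isInverse zero)) z r) ($-I z r))

    later-axes-span : Spans (u ∘ suc)
    later-axes-span (ψ , ann , ψ≉0) =
      μ-not-eigenvalue zero (rank≤1-left-eigenvector⇒eigenvalue (rank≤1 zero) μ≉1 ψ ψ≉0 ψg₀≈μψ)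
      where
      open ≈-Reasoning
      later-invariant : ∀ i y → dot ψ (g (suc i) $ y) ≈ dot ψ y
      later-invariant i = axis-annihilator-invariant (rank≤1 (suc i)) (trans (dot-comm ψ _) (ann i))
      ψg₀≈μψ : ∀ x → dot ψ (g zero $ x) ≈ μ * dot ψ x
      ψg₀≈μψ x = begin
        dot ψ (g zero $ x)                      ≈⟨ prodₘ-preserves (g ∘ suc) ψ later-invariant _ ⟨
        dot ψ (prodₘ (g ∘ suc) $ (g zero $ x))  ≈⟨ dot-congʳ ψ (tail-after-head x) ⟩
        dot ψ (μ ·ᵥ x)                          ≈⟨ dot-·ʳ ψ μ x ⟩
        μ * dot ψ x                             ∎

    head-moves-later-axes : ∀ j → ¬ (g zero $ u (suc j)) ≈ᵥ u (suc j)
    head-moves-later-axes j g₀v≈v =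
      independent d relation λ d≈0 → μ-not-eigenvalue (suc j) (v , v≉0 , eigen d≈0)
      where
      open ≈-Reasoning
      v = u (suc j)
      independent : LinearlyIndependent (u ∘ suc)
      independent = spans⇒linearlyIndependent (u ∘ suc) later-axes-span
      v≉0 : NonZeroVec v
      v≉0 = linearlyIndependent⇒nonzero independent j
      Pv≈μv : (prodₘ (g ∘ suc) $ v) ≈ᵥ (μ ·ᵥ v)
      Pv≈μv r = trans ($-congʳ (prodₘ (g ∘ suc)) (sym ∘ g₀v≈v) r) (tail-after-head v r)
      cs = telescope-coeff (g ∘ suc) (rank≤1 ∘ suc) v
      d : Fin n → Carrier
      d i = cs i - (μ - 1#) * δ j i
      relation : lc d (u ∘ suc) ≈ᵥ 0ᵥ
      relation r = begin
        lc d (u ∘ suc) r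
          ≈⟨ dot-−ˡ cs ((μ - 1#) ·ᵥ δ j) _ ⟩
        lc cs (u ∘ suc) r - dot ((μ - 1#) ·ᵥ δ j) (λ i → u (suc i) r)
          ≈⟨ +-congˡ (-‿cong (dot-·ˡ (μ - 1#) (δ j) _)) ⟩
        lc cs (u ∘ suc) r - (μ - 1#) * lc (δ j) (u ∘ suc) r
          ≈⟨ +-cong (telescope-eigenvector (g ∘ suc) (rank≤1 ∘ suc) Pv≈μv r)
                    (-‿cong (*-congˡ (lc-basis j (u ∘ suc) r))) ⟩
        (μ - 1#) * v r - (μ - 1#) * v r
          ≈⟨ -‿inverseʳ _ ⟩
        0# ∎
      -- only the j-th factor of the telescoping sum survives, and it scales v by μ - 1
      eigen : (∀ i → d i ≈ 0#) → (g (suc j) $ v) ≈ᵥ (μ ·ᵥ v)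
      eigen d≈0 r = begin
        (g (suc j) $ v) r    ≈⟨ $-congʳ (g (suc j)) (sym ∘ y≈v) r ⟩
        (g (suc j) $ y) r    ≈⟨ perturbation-$ (rank≤1 (suc j)) y r ⟩
        y r + cs j * v r     ≈⟨ +-cong (y≈v r) (*-congʳ csⱼ≈μ-1) ⟩
        v r + (μ - 1#) * v r ≈⟨ 1+a≈μ⇒x+ax≈μx (v r) (x+[y-x]≈y 1# μ) ⟩
        μ * v r              ∎
        where
        cs≈[μ-1]δ : ∀ i → cs i ≈ (μ - 1#) * δ j i
        cs≈[μ-1]δ i = x-y≈0⇒x≈y (d≈0 i)
        csᵢ≈0 : ∀ i → i ≢ j → cs i ≈ 0#
        csᵢ≈0 i i≢j = trans (cs≈[μ-1]δ i) (trans (*-congˡ (reflexive (δ-off (i≢j ∘ ≡.sym)))) (zeroʳ _))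
        csⱼ≈μ-1 : cs j ≈ μ - 1#
        csⱼ≈μ-1 = trans (cs≈[μ-1]δ j) (trans (*-congˡ (reflexive (δ-diag j))) (*-identityʳ _))
        y = suffix (g ∘ suc) j $ v
        y≈v : y ≈ᵥ v
        y≈v = suffix-fixes (g ∘ suc) (rank≤1 ∘ suc) v j csᵢ≈0

  rotate : ∀ {n} → ScalarRelation n → ScalarRelation n
  rotate R = record
    { g                = g ∘ suc-cyclic
    ; ginv             = ginv ∘ suc-cyclic
    ; μ                = μ
    ; isInverse        = isInverse ∘ suc-cyclic
    ; rank≤1           = rank≤1 ∘ suc-cyclic
    ; product          = λ x r → trans (prodₘ-rotate g x r) (tail-after-head x r)
    ; μ≉1              = μ≉1
    ; μ-not-eigenvalue = μ-not-eigenvalue ∘ suc-cyclic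
    }
    where open ScalarRelation R

  MovesOtherAxes : ∀ {n} → Fin (suc n) → Set (c ⊔ ℓ)
  MovesOtherAxes {n} i = ∀ (R : ScalarRelation n) j → i ≢ j → let open ScalarRelation R in ¬ (g i $ u j) ≈ᵥ u j

  -- Rotating the factors cyclically moves any index i to 0 without breaking the hypotheses.
  moves-other-axes : ∀ {n} i → MovesOtherAxes {n} i
  moves-other-axes {n} = <-weakInduction MovesOtherAxes base step
    where
    base : MovesOtherAxes zero
    base R zero    0≢0 = contradiction ≡.refl 0≢0
    base R (suc j) _   = ScalarRelation.head-moves-later-axes R j
    step : ∀ i → MovesOtherAxes (inject₁ i) → MovesOtherAxes (suc i)
    step i moves R j i+1≢j fixed with suc-cyclic-surjective j
    ... | k , ≡.refl = moves (rotate R) k (λ { ≡.refl → i+1≢j (≡.sym (suc-cyclic-inject₁ i)) })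
                         (≡.subst (λ l → (g l $ u (suc-cyclic k)) ≈ᵥ u (suc-cyclic k))
                                  (≡.sym (suc-cyclic-inject₁ i)) fixed)
      where open ScalarRelation R

  module _ {n} (R : ScalarRelation n) where
    open ScalarRelation R

    pseudoreflection : 1 ≤ n → ∀ i → IsPseudoreflection (g i)
    pseudoreflection (s≤s z≤n) i with another i
    ... | j , i≢j = rank≤1 i , u j , moves-other-axes i R j i≢j ∘ kernel⇒fixed (g i)

    module _ (W : Subspace n) (invariant : ∀ i {x} → Subspace._∈W W x → Subspace._∈W W (g i $ x)) where
      open Subspace W

      axis-∈ : ∀ j {x} → x ∈W → ¬ coeff (rank≤1 j) x ≈ 0# → u j ∈W
      axis-∈ j x∈ c≉0 =
        ·-cancel W c≉0 (respects (image-on-axis (rank≤1 j) _) (-ₘIₘ-closed W (g j) x∈ (invariant j x∈)))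

      ¬¬some-axis-∈ : ∀ {w} → w ∈W → NonZeroVec w → ¬ ¬ Σ (Fin (suc n)) λ i → u i ∈W
      ¬¬some-axis-∈ {w} w∈ w≉0 none = ¬¬-distrib-∀ ¬¬fixed all-fixed⇒⊥
        where
        ¬¬fixed : ∀ i → ¬ ¬ (g i $ w) ≈ᵥ w
        ¬¬fixed i ¬fixed = none (i , axis-∈ i w∈ (¬fixed ∘ coeff≈0⇒fixed (rank≤1 i)))
        all-fixed⇒⊥ : ¬ (∀ i → (g i $ w) ≈ᵥ w)
        all-fixed⇒⊥ fixed = w≉0 λ r → x≈μx⇒x≈0 μ≉1 (trans (sym (prodₘ-fixes g fixed r)) (product w r))

      all-axes-∈ : ∀ {i} → u i ∈W → ∀ j → u j ∈W
      all-axes-∈ {i} uᵢ∈ j with j ≟ i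
      ... | yes ≡.refl = uᵢ∈
      ... | no j≢i     = axis-∈ j uᵢ∈ (moves-other-axes j R i j≢i ∘ coeff≈0⇒fixed (rank≤1 j))

      all-axes⇒all-∈ : (∀ j → u j ∈W) → ∀ v → v ∈W
      all-axes⇒all-∈ axes v =
        ·-cancel W (μ-1≉0 μ≉1) (respects (telescope-eigenvector g rank≤1 (product v)) (lc-closed W (telescope-coeff g rank≤1 v) u axes))

    irreducible : Irreducible (InGenerated g ginv)
    irreducible (W , invariant , (w , w∈ , w≉0) , (v , v∉)) =
      ¬¬some-axis-∈ W invariantᵢ w∈ w≉0 λ (i , uᵢ∈) →
        v∉ (all-axes⇒all-∈ W invariantᵢ (all-axes-∈ W invariantᵢ uᵢ∈) v)
      where
      invariantᵢ : ∀ i {x} → Subspace._∈W W x → Subspace._∈W W (g i $ x)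
      invariantᵢ i {x} = invariant (g i) (gen i) x

open Defs

mainTheorem7 : ∀ {c ℓ : Level} (F : Field c ℓ) (n : ℕ) → 1 ≤ n →
    (g ginv : Fin (suc n) → Matrix F n) (μ : Field.Carrier F) →
    (∀ i → IsInverse F (g i) (ginv i)) →
    (∀ i → RankLe1 F (_-ₘ_ F (g i) (Iₘ F))) →
    _≈ₘ_ F (prodₘ F g) (scalar F μ) →
    ¬ (Field._≈_ F μ (Field.1# F)) →
    (∀ i → ¬ IsEigenvalue F μ (g i)) →
    (∀ i → IsPseudoreflection F (g i)) × Irreducible F (InGenerated F g ginv)
mainTheorem7 F n 1≤n g ginv μ isInverse rank≤1 prod≈μ μ≉1 μ-not-eigenvalue =
  pseudoreflection F R 1≤n , irreducible F R
  where
  R : ScalarRelation F n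
  R = record
    { g                = g
    ; ginv             = ginv
    ; μ                = μ
    ; isInverse        = isInverse
    ; rank≤1           = rank≤1
    ; product          = ≈scalar⇒$ F prod≈μ
    ; μ≉1              = μ≉1
    ; μ-not-eigenvalue = μ-not-eigenvalue
    }
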